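{- Let $G=(V,\lambda)$ be an $\mathbb{F}_p$-labeled hypergraph. Then: (i) a subset $C\subseteq V$ is fully symmetric if and only if $\mathrm{Sym}(C)\leq\mathrm{Aut}(G)$ (where $\mathrm{Sym}(C)$ is viewed as the subgroup of $\mathrm{Sym}(V)$ fixing $V\setminus C$ pointwise); (ii) if $C,D\subseteq V$ are fully symmetric with $C\cap D\neq\emptyset$, then $C\cup D$ is fully symmetric; (iii) if $C\subseteq V$ is a maximal (with respect to inclusion) fully symmetric set with $|C|>|V|/2$, then $\mathrm{Aut}(G)=\mathrm{Sym}(C)\times\Gamma$ for some $\Gamma\leq\mathrm{Sym}(V\setminus C)$.
   Context: An $\mathbb{F}_p$-labeled hypergraph is $G=(V,\lambda)$ with $V$ finite and $\lambda\colon\mathcal{P}(V)\setminus\{\emptyset\}\to\mathbb{F}_p$. $\mathrm{Aut}(G)$ is the group of $\pi\in\mathrm{Sym}(V)$ with $\lambda(\pi(e))=\lambda(e)$ for all nonempty $e\subseteq V$. $C\subseteq V$ is fully symmetric if $\lambda(e_1)=\lambda(e_2)$ for all nonempty $e_1,e_2\subseteq V$ with $|e_1|=|e_2|$ and $e_1\cap(V\setminus C)=e_2\cap(V\setminus C)$. -}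

module Defs where

open import Data.Nat using (ℕ)
open import Data.Fin using (Fin)
open import Data.Fin.Subset using (Subset; Nonempty; ∣_∣; _∩_; _∪_; ∁; _∈_; _∉_; _⊆_)
open import Data.Fin.Permutation using (Permutation′; _⟨$⟩ʳ_; _⟨$⟩ˡ_)
open import Data.Vec using (tabulate; lookup)
open import Data.Product using (Σ; _×_; _,_)
open import Function.Bundles using (_⇔_)
open import Relation.Binary.PropositionalEquality using (_≡_)

-- An F_p-labeled hypergraph on vertex set V = Fin n: labels of subsets.
-- The label of the empty set is irrelevant (all conditions below only
-- quantify over nonempty edges).
Labeling : ℕ → ℕ → Set
Labeling n p = Subset n → Fin p

image : ∀ {n} → Permutation′ n → Subset n → Subset n
image π e = tabulate (λ y → lookup e (π ⟨$⟩ˡ y))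

IsAut : ∀ {n p} → Labeling n p → Permutation′ n → Set
IsAut lab π = ∀ e → Nonempty e → lab (image π e) ≡ lab e

InSym : ∀ {n} → Subset n → Permutation′ n → Set
InSym C π = ∀ x → x ∉ C → π ⟨$⟩ʳ x ≡ x

SymLeAut : ∀ {n p} → Labeling n p → Subset n → Set
SymLeAut lab C = ∀ π → InSym C π → IsAut lab π

FullySymmetric : ∀ {n p} → Labeling n p → Subset n → Set
FullySymmetric lab C =
  ∀ e₁ e₂ → Nonempty e₁ → Nonempty e₂ → ∣ e₁ ∣ ≡ ∣ e₂ ∣ →
  e₁ ∩ ∁ C ≡ e₂ ∩ ∁ C → lab e₁ ≡ lab e₂

MaximalFullySymmetric : ∀ {n p} → Labeling n p → Subset n → Set
MaximalFullySymmetric lab C =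
  FullySymmetric lab C × (∀ D → FullySymmetric lab D → C ⊆ D → D ≡ C)

_≗ₚ_ : ∀ {n} → Permutation′ n → Permutation′ n → Set
π ≗ₚ ρ = ∀ x → π ⟨$⟩ʳ x ≡ ρ ⟨$⟩ʳ x

IsSubgroup : ∀ {n} → (Permutation′ n → Set) → Set
IsSubgroup {n} Γ =
  (∀ π ρ → π ≗ₚ ρ → Γ π → Γ ρ) ×
  ((∀ (π : Permutation′ n) → (∀ x → π ⟨$⟩ʳ x ≡ x) → Γ π) ×
  ((∀ π ρ → Γ π → Γ ρ → ∀ τ → (∀ x → τ ⟨$⟩ʳ x ≡ π ⟨$⟩ʳ (ρ ⟨$⟩ʳ x)) → Γ τ) ×
   (∀ π → Γ π → ∀ τ → (∀ x → τ ⟨$⟩ʳ x ≡ π ⟨$⟩ˡ x) → Γ τ)))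

AutIsSymTimes : ∀ {n p} → Labeling n p → Subset n → Set₁
AutIsSymTimes {n} lab C =
  Σ (Permutation′ n → Set) λ Γ →
    IsSubgroup Γ × (∀ γ → Γ γ → InSym (∁ C) γ) ×
    (∀ π → IsAut lab π ⇔
       Σ (Permutation′ n) λ σ → Σ (Permutation′ n) λ γ →
         InSym C σ × Γ γ × (∀ x → π ⟨$⟩ʳ x ≡ σ ⟨$⟩ʳ (γ ⟨$⟩ʳ x)))

{-# OPTIONS --safe #-}

-- (i) Sym(C) is generated by the transpositions of C, and any two edges of
-- equal size that agree outside C are joined by a chain of such
-- transpositions, each moving one vertex of e₁ ∖ e₂ onto one of e₂ ∖ e₁.
-- (ii) If z ∈ C ∩ D then (x y) = (x z)(z y)(x z), so every transposition of
-- C ∪ D is an automorphism.  (iii) An automorphism π maps C to a fully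
-- symmetric set π(C) of the same size; since |C| > |V|/2 it meets C, so by
-- (ii) and maximality π(C) ⊆ C.  Hence π preserves C and V ∖ C, and splits
-- into its restrictions to C and to V ∖ C.
module Submission where

open import Defs
open import Data.Nat using (ℕ; suc; _+_; _*_; _<_; _≤_)
open import Data.Nat.Properties
  using (+-0-commutativeMonoid; +-suc; +-identityʳ; ≤-reflexive; <⇒≱)
open import Data.Nat.Induction using (<-wellFounded)
open import Data.Nat.Primality using (Prime)
open import Data.Bool using (true; false; if_then_else_)
open import Data.Fin using (Fin; _≟_)
open import Data.Fin.Properties using (any?)
open import Data.Fin.Subset
  using (Subset; Nonempty; ∣_∣; _∩_; _∪_; ∁; _∈_; _∉_; _⊆_; _⊂_; ⊥)
open import Data.Fin.Subset.Properties
  using ( _∈?_; nonempty?; Empty-unique; ∣⊥∣≡0; ∣p∣≤n; ⊆-antisym; p⊂q⇒∣p∣<∣q∣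
        ; x∈p∩q⁺; x∈p∩q⁻; x∈p∪q⁻; p⊆p∪q; q⊆p∪q
        ; x∈p⇒x∉∁p; x∈∁p⇒x∉p; x∉p⇒x∈∁p )
open import Data.Fin.Permutation
  using (Permutation′; _⟨$⟩ʳ_; _⟨$⟩ˡ_; inverseˡ; inverseʳ; flip; _∘ₚ_; permutation; transpose)
  renaming (id to idₚ)
import Data.Fin.Permutation.Components as PC
open import Data.Vec using ([]; _∷_; tabulate; lookup)
open import Data.Vec.Properties
  using (lookup∘tabulate; tabulate∘lookup; tabulate-cong; []=⇒lookup; lookup⇒[]=)
open import Data.Product using (∃; _×_; _,_; proj₁; proj₂)
open import Data.Sum using (_⊎_; inj₁; inj₂)
open import Function using (_∘′_)
open import Function.Bundles using (_⇔_; mk⇔)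
open import Induction.WellFounded using (Acc; acc)
open import Relation.Nullary using (¬_; Dec; yes; no; does; contradiction)
open import Relation.Nullary.Decidable using (_×-dec_; ¬?; decidable-stable)
open import Relation.Binary.PropositionalEquality
open import Algebra.Properties.CommutativeMonoid.Sum +-0-commutativeMonoid
  using (sum; sum-cong-≗; sum-permute)

private
  variable
    n p : ℕ
    π ρ : Permutation′ n
    e e₁ e₂ C D : Subset n
    x y z : Fin n

⟨$⟩ˡ-cong : (π ρ : Permutation′ n) → π ≗ₚ ρ → ∀ y → π ⟨$⟩ˡ y ≡ ρ ⟨$⟩ˡ y
⟨$⟩ˡ-cong π ρ π≗ρ y = begin
  π ⟨$⟩ˡ y                     ≡⟨ cong (π ⟨$⟩ˡ_) (inverseʳ ρ) ⟨
  π ⟨$⟩ˡ (ρ ⟨$⟩ʳ (ρ ⟨$⟩ˡ y))  ≡⟨ cong (π ⟨$⟩ˡ_) (π≗ρ _) ⟨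
  π ⟨$⟩ˡ (π ⟨$⟩ʳ (ρ ⟨$⟩ˡ y))  ≡⟨ inverseˡ π ⟩
  ρ ⟨$⟩ˡ y                     ∎
  where open ≡-Reasoning

transpose-matchˡ : (i j : Fin n) → PC.transpose i j i ≡ j
transpose-matchˡ i j with i ≟ i
... | yes _  = refl
... | no i≢i = contradiction refl i≢i

transpose-matchʳ : (i j : Fin n) → PC.transpose i j j ≡ i
transpose-matchʳ i j with j ≟ i
... | yes j≡i = j≡i
... | no _ with j ≟ j
...   | yes _  = refl
...   | no j≢j = contradiction refl j≢j

transpose-mismatch : (i j : Fin n) → ¬ x ≡ i → ¬ x ≡ j → PC.transpose i j x ≡ x
transpose-mismatch {x = x} i j x≢i x≢j with x ≟ i
... | yes x≡i = contradiction x≡i x≢i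
... | no _ with x ≟ j
...   | yes x≡j = contradiction x≡j x≢j
...   | no _    = refl

transpose-same : (i : Fin n) → transpose i i ≗ₚ idₚ
transpose-same i x = cases (x ≟ i)
  where
  cases : Dec (x ≡ i) → PC.transpose i i x ≡ x
  cases (yes refl) = transpose-matchˡ x x
  cases (no x≢i)   = transpose-mismatch i i x≢i x≢i

transpose-conjugate : ¬ x ≡ y → ¬ x ≡ z → ¬ y ≡ z →
                      transpose x y ≗ₚ (transpose x z ∘ₚ transpose z y ∘ₚ transpose x z)
transpose-conjugate {x = x} {y} {z} x≢y x≢z y≢z w = cases (w ≟ x) (w ≟ y) (w ≟ z)
  where
  via : ∀ {a b c} → PC.transpose x z w ≡ a → PC.transpose z y a ≡ b → PC.transpose x z b ≡ c →
        PC.transpose x z (PC.transpose z y (PC.transpose x z w)) ≡ c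
  via refl refl r = r

  cases : Dec (w ≡ x) → Dec (w ≡ y) → Dec (w ≡ z) →
          PC.transpose x y w ≡ PC.transpose x z (PC.transpose z y (PC.transpose x z w))
  cases (yes refl) _ _ = trans (transpose-matchˡ x y)
    (sym (via (transpose-matchˡ x z) (transpose-matchˡ z y) (transpose-mismatch x z (x≢y ∘′ sym) y≢z)))
  cases (no w≢x) (yes refl) _ = trans (transpose-matchʳ x y)
    (sym (via (transpose-mismatch x z w≢x y≢z) (transpose-matchʳ z y) (transpose-matchʳ x z)))
  cases (no w≢x) (no w≢y) (yes refl) = trans (transpose-mismatch x y w≢x w≢y)
    (sym (via (transpose-matchʳ x z) (transpose-mismatch z y x≢z x≢y) (transpose-matchˡ x z)))
  cases (no w≢x) (no w≢y) (no w≢z) = trans (transpose-mismatch x y w≢x w≢y)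
    (sym (via (transpose-mismatch x z w≢x w≢z) (transpose-mismatch z y w≢z w≢y) (transpose-mismatch x z w≢x w≢z)))

⊆⊎∃∉ : (e₁ e₂ : Subset n) → e₁ ⊆ e₂ ⊎ ∃ λ x → x ∈ e₁ × x ∉ e₂
⊆⊎∃∉ e₁ e₂ with any? (λ x → x ∈? e₁ ×-dec ¬? (x ∈? e₂))
... | yes witness = inj₂ witness
... | no none     = inj₁ λ {x} x∈e₁ → decidable-stable (x ∈? e₂) (λ x∉e₂ → none (x , x∈e₁ , x∉e₂))

p⊆q∧∣q∣≤∣p∣⇒p≡q : e₁ ⊆ e₂ → ∣ e₂ ∣ ≤ ∣ e₁ ∣ → e₁ ≡ e₂
p⊆q∧∣q∣≤∣p∣⇒p≡q {e₁ = e₁} {e₂} e₁⊆e₂ ∣e₂∣≤∣e₁∣ with ⊆⊎∃∉ e₂ e₁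
... | inj₁ e₂⊆e₁              = ⊆-antisym e₁⊆e₂ e₂⊆e₁
... | inj₂ (y , y∈e₂ , y∉e₁) = contradiction ∣e₂∣≤∣e₁∣ (<⇒≱ (p⊂q⇒∣p∣<∣q∣ (e₁⊆e₂ , y , y∈e₂ , y∉e₁)))

∣p∣≤∣q∣∧p⊈q⇒∃q∖p : ∣ e₁ ∣ ≤ ∣ e₂ ∣ → x ∈ e₁ → x ∉ e₂ → ∃ λ y → y ∈ e₂ × y ∉ e₁
∣p∣≤∣q∣∧p⊈q⇒∃q∖p {e₁ = e₁} {e₂} {x} ∣e₁∣≤∣e₂∣ x∈e₁ x∉e₂ with ⊆⊎∃∉ e₂ e₁
... | inj₂ witness = witness
... | inj₁ e₂⊆e₁   = contradiction ∣e₁∣≤∣e₂∣ (<⇒≱ (p⊂q⇒∣p∣<∣q∣ (e₂⊆e₁ , x , x∈e₁ , x∉e₂)))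

∩∁-≡⇒∈ : e₁ ∩ ∁ C ≡ e₂ ∩ ∁ C → x ∈ e₁ → x ∉ e₂ → x ∈ C
∩∁-≡⇒∈ {C = C} {e₂ = e₂} {x = x} e₁≈e₂ x∈e₁ x∉e₂ = decidable-stable (x ∈? C) λ x∉C →
  x∉e₂ (proj₁ (x∈p∩q⁻ e₂ (∁ C) (subst (x ∈_) e₁≈e₂ (x∈p∩q⁺ (x∈e₁ , x∉p⇒x∈∁p x∉C)))))

∣p∣≡sum : (e : Subset n) → ∣ e ∣ ≡ sum (λ i → if lookup e i then 1 else 0)
∣p∣≡sum []          = refl
∣p∣≡sum (true ∷ e)  = cong suc (∣p∣≡sum e)
∣p∣≡sum (false ∷ e) = ∣p∣≡sum e

∣p∪q∣+∣p∩q∣≡∣p∣+∣q∣ : (e₁ e₂ : Subset n) → ∣ e₁ ∪ e₂ ∣ + ∣ e₁ ∩ e₂ ∣ ≡ ∣ e₁ ∣ + ∣ e₂ ∣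
∣p∪q∣+∣p∩q∣≡∣p∣+∣q∣ []          []          = refl
∣p∪q∣+∣p∩q∣≡∣p∣+∣q∣ (true ∷ e₁)  (true ∷ e₂)  = cong suc (begin
  ∣ e₁ ∪ e₂ ∣ + suc ∣ e₁ ∩ e₂ ∣  ≡⟨ +-suc _ _ ⟩
  suc (∣ e₁ ∪ e₂ ∣ + ∣ e₁ ∩ e₂ ∣) ≡⟨ cong suc (∣p∪q∣+∣p∩q∣≡∣p∣+∣q∣ e₁ e₂) ⟩
  suc (∣ e₁ ∣ + ∣ e₂ ∣)           ≡⟨ +-suc _ _ ⟨
  ∣ e₁ ∣ + suc ∣ e₂ ∣             ∎)
  where open ≡-Reasoning
∣p∪q∣+∣p∩q∣≡∣p∣+∣q∣ (true ∷ e₁)  (false ∷ e₂) = cong suc (∣p∪q∣+∣p∩q∣≡∣p∣+∣q∣ e₁ e₂)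
∣p∪q∣+∣p∩q∣≡∣p∣+∣q∣ (false ∷ e₁) (true ∷ e₂)  = trans (cong suc (∣p∪q∣+∣p∩q∣≡∣p∣+∣q∣ e₁ e₂)) (sym (+-suc _ _))
∣p∪q∣+∣p∩q∣≡∣p∣+∣q∣ (false ∷ e₁) (false ∷ e₂) = ∣p∪q∣+∣p∩q∣≡∣p∣+∣q∣ e₁ e₂

n<∣p∣+∣q∣⇒p∩q≢∅ : (e₁ e₂ : Subset n) → n < ∣ e₁ ∣ + ∣ e₂ ∣ → Nonempty (e₁ ∩ e₂)
n<∣p∣+∣q∣⇒p∩q≢∅ {n} e₁ e₂ n<∣e₁∣+∣e₂∣ with nonempty? (e₁ ∩ e₂)
... | yes e₁∩e₂≢∅ = e₁∩e₂≢∅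
... | no  e₁∩e₂≡∅ = contradiction (∣p∣≤n (e₁ ∪ e₂)) (<⇒≱ (subst (n <_) ∣e₁∣+∣e₂∣≡∣e₁∪e₂∣ n<∣e₁∣+∣e₂∣))
  where
  open ≡-Reasoning
  ∣e₁∣+∣e₂∣≡∣e₁∪e₂∣ : ∣ e₁ ∣ + ∣ e₂ ∣ ≡ ∣ e₁ ∪ e₂ ∣
  ∣e₁∣+∣e₂∣≡∣e₁∪e₂∣ = begin
    ∣ e₁ ∣ + ∣ e₂ ∣              ≡⟨ ∣p∪q∣+∣p∩q∣≡∣p∣+∣q∣ e₁ e₂ ⟨
    ∣ e₁ ∪ e₂ ∣ + ∣ e₁ ∩ e₂ ∣    ≡⟨ cong (λ e → ∣ e₁ ∪ e₂ ∣ + ∣ e ∣) (Empty-unique e₁∩e₂≡∅) ⟩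
    ∣ e₁ ∪ e₂ ∣ + ∣ ⊥ {n = n} ∣  ≡⟨ cong (∣ e₁ ∪ e₂ ∣ +_) (∣⊥∣≡0 n) ⟩
    ∣ e₁ ∪ e₂ ∣ + 0              ≡⟨ +-identityʳ _ ⟩
    ∣ e₁ ∪ e₂ ∣                  ∎

lookup-image : (π : Permutation′ n) (e : Subset n) (y : Fin n) →
               lookup (image π e) y ≡ lookup e (π ⟨$⟩ˡ y)
lookup-image π e = lookup∘tabulate _

∈-image⁺ : (π : Permutation′ n) → π ⟨$⟩ˡ y ∈ e → y ∈ image π e
∈-image⁺ {y = y} {e} π πˡy∈e = lookup⇒[]= y (image π e) (trans (lookup-image π e y) ([]=⇒lookup πˡy∈e))

∈-image⁻ : (π : Permutation′ n) → y ∈ image π e → π ⟨$⟩ˡ y ∈ e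
∈-image⁻ {y = y} {e} π y∈πe = lookup⇒[]= (π ⟨$⟩ˡ y) e (trans (sym (lookup-image π e y)) ([]=⇒lookup y∈πe))

∈-image-⟨$⟩ʳ : (π : Permutation′ n) → x ∈ e → π ⟨$⟩ʳ x ∈ image π e
∈-image-⟨$⟩ʳ {e = e} π x∈e = ∈-image⁺ π (subst (_∈ e) (sym (inverseˡ π)) x∈e)

∉-image-⟨$⟩ʳ : (π : Permutation′ n) → x ∉ e → π ⟨$⟩ʳ x ∉ image π e
∉-image-⟨$⟩ʳ {e = e} π x∉e πx∈πe = x∉e (subst (_∈ e) (inverseˡ π) (∈-image⁻ π πx∈πe))

image-nonempty : (π : Permutation′ n) → Nonempty e → Nonempty (image π e)
image-nonempty π (x , x∈e) = π ⟨$⟩ʳ x , ∈-image-⟨$⟩ʳ π x∈e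

image-cong : (π ρ : Permutation′ n) → π ≗ₚ ρ → (e : Subset n) → image π e ≡ image ρ e
image-cong π ρ π≗ρ e = tabulate-cong (λ y → cong (lookup e) (⟨$⟩ˡ-cong π ρ π≗ρ y))

image-id : (e : Subset n) → image idₚ e ≡ e
image-id = tabulate∘lookup

image-∘ₚ : (π ρ : Permutation′ n) (e : Subset n) → image (π ∘ₚ ρ) e ≡ image ρ (image π e)
image-∘ₚ π ρ e = tabulate-cong (λ y → sym (lookup-image π e (ρ ⟨$⟩ˡ y)))

image-flip : (π : Permutation′ n) (e : Subset n) → image π (image (flip π) e) ≡ e
image-flip π e = begin
  image π (image (flip π) e)  ≡⟨ image-∘ₚ (flip π) π e ⟨
  image (flip π ∘ₚ π) e       ≡⟨ image-cong (flip π ∘ₚ π) idₚ (λ _ → inverseʳ π) e ⟩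
  image idₚ e                 ≡⟨ image-id e ⟩
  e                           ∎
  where open ≡-Reasoning

∣image∣ : (π : Permutation′ n) (e : Subset n) → ∣ image π e ∣ ≡ ∣ e ∣
∣image∣ π e = begin
  ∣ image π e ∣                                      ≡⟨ ∣p∣≡sum (image π e) ⟩
  sum (λ i → indicator (lookup (image π e) i))       ≡⟨ sum-cong-≗ (λ i → cong indicator (lookup-image π e i)) ⟩
  sum (λ i → indicator (lookup e (π ⟨$⟩ˡ i)))        ≡⟨ sum-permute (indicator ∘′ lookup e) (flip π) ⟨
  sum (λ i → indicator (lookup e i))                 ≡⟨ ∣p∣≡sum e ⟨
  ∣ e ∣                                              ∎
  where
  open ≡-Reasoning
  indicator = λ b → if b then 1 else 0

module _ (lab : Labeling n p) where

  IsAut-cong : (π ρ : Permutation′ n) → π ≗ₚ ρ → IsAut lab π → IsAut lab ρ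
  IsAut-cong π ρ π≗ρ π-aut e ne = trans (cong lab (sym (image-cong π ρ π≗ρ e))) (π-aut e ne)

  IsAut-id : IsAut lab idₚ
  IsAut-id e _ = cong lab (image-id e)

  IsAut-∘ₚ : (π ρ : Permutation′ n) → IsAut lab π → IsAut lab ρ → IsAut lab (π ∘ₚ ρ)
  IsAut-∘ₚ π ρ π-aut ρ-aut e ne = begin
    lab (image (π ∘ₚ ρ) e)      ≡⟨ cong lab (image-∘ₚ π ρ e) ⟩
    lab (image ρ (image π e))   ≡⟨ ρ-aut (image π e) (image-nonempty π ne) ⟩
    lab (image π e)             ≡⟨ π-aut e ne ⟩
    lab e                       ∎
    where open ≡-Reasoning

  IsAut-flip : (π : Permutation′ n) → IsAut lab π → IsAut lab (flip π)
  IsAut-flip π π-aut e ne = begin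
    lab (image (flip π) e)             ≡⟨ π-aut (image (flip π) e) (image-nonempty (flip π) ne) ⟨
    lab (image π (image (flip π) e))   ≡⟨ cong lab (image-flip π e) ⟩
    lab e                              ∎
    where open ≡-Reasoning

  IsAut-isSubgroup : IsSubgroup (IsAut lab)
  IsAut-isSubgroup =
      IsAut-cong
    , (λ π π≗id → IsAut-cong idₚ π (λ x → sym (π≗id x)) IsAut-id)
    , (λ π ρ π-aut ρ-aut τ τ≗πρ → IsAut-cong (ρ ∘ₚ π) τ (λ x → sym (τ≗πρ x)) (IsAut-∘ₚ ρ π ρ-aut π-aut))
    , (λ π π-aut τ τ≗π⁻¹ → IsAut-cong (flip π) τ (λ x → sym (τ≗π⁻¹ x)) (IsAut-flip π π-aut))

InSym-⟨$⟩ˡ : (π : Permutation′ n) → InSym C π → x ∉ C → π ⟨$⟩ˡ x ≡ x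
InSym-⟨$⟩ˡ {x = x} π π-fixes x∉C = trans (cong (π ⟨$⟩ˡ_) (sym (π-fixes x x∉C))) (inverseˡ π)

InSym-isSubgroup : (C : Subset n) → IsSubgroup (InSym C)
InSym-isSubgroup C =
    (λ π ρ π≗ρ π-fixes x x∉C → trans (sym (π≗ρ x)) (π-fixes x x∉C))
  , (λ π π≗id x _ → π≗id x)
  , (λ π ρ π-fixes ρ-fixes τ τ≗πρ x x∉C →
       trans (τ≗πρ x) (trans (cong (π ⟨$⟩ʳ_) (ρ-fixes x x∉C)) (π-fixes x x∉C)))
  , (λ π π-fixes τ τ≗π⁻¹ x x∉C → trans (τ≗π⁻¹ x) (InSym-⟨$⟩ˡ π π-fixes x∉C))

IsSubgroup-× : {Γ Δ : Permutation′ n → Set} → IsSubgroup Γ → IsSubgroup Δ → IsSubgroup (λ π → Γ π × Δ π)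
IsSubgroup-× (Γ-cong , Γ-id , Γ-comp , Γ-inv) (Δ-cong , Δ-id , Δ-comp , Δ-inv) =
    (λ π ρ π≗ρ (γ , δ) → Γ-cong π ρ π≗ρ γ , Δ-cong π ρ π≗ρ δ)
  , (λ π π≗id → Γ-id π π≗id , Δ-id π π≗id)
  , (λ π ρ (γπ , δπ) (γρ , δρ) τ τ≗πρ → Γ-comp π ρ γπ γρ τ τ≗πρ , Δ-comp π ρ δπ δρ τ τ≗πρ)
  , (λ π (γ , δ) τ τ≗π⁻¹ → Γ-inv π γ τ τ≗π⁻¹ , Δ-inv π δ τ τ≗π⁻¹)

-- Fully symmetric sets

image-∩∁ : (π : Permutation′ n) → InSym C π → (e : Subset n) → image π e ∩ ∁ C ≡ e ∩ ∁ C
image-∩∁ {C = C} π π-fixes e = ⊆-antisym image⊆ ⊆image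
  where
  fixed : x ∈ ∁ C → π ⟨$⟩ˡ x ≡ x
  fixed x∈∁C = InSym-⟨$⟩ˡ π π-fixes (x∈∁p⇒x∉p x∈∁C)

  image⊆ : image π e ∩ ∁ C ⊆ e ∩ ∁ C
  image⊆ x∈ = let x∈πe , x∈∁C = x∈p∩q⁻ (image π e) (∁ C) x∈ in
    x∈p∩q⁺ (subst (_∈ e) (fixed x∈∁C) (∈-image⁻ π x∈πe) , x∈∁C)

  ⊆image : e ∩ ∁ C ⊆ image π e ∩ ∁ C
  ⊆image x∈ = let x∈e , x∈∁C = x∈p∩q⁻ e (∁ C) x∈ in
    x∈p∩q⁺ (∈-image⁺ π (subst (_∈ e) (sym (fixed x∈∁C)) x∈e) , x∈∁C)

transpose-InSym : x ∈ C → y ∈ C → InSym C (transpose x y)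
transpose-InSym {x = x} {C} {y} x∈C y∈C z z∉C =
  transpose-mismatch x y (λ z≡x → z∉C (subst (_∈ C) (sym z≡x) x∈C)) (λ z≡y → z∉C (subst (_∈ C) (sym z≡y) y∈C))

transpose-shrinks : y ∈ e₁ → y ∉ e₂ → x ∈ e₂ → x ∉ e₁ → image (transpose y x) e₁ ∩ ∁ e₂ ⊂ e₁ ∩ ∁ e₂
transpose-shrinks {y = y} {e₁} {e₂} {x} y∈e₁ y∉e₂ x∈e₂ x∉e₁ =
  shrink , y , x∈p∩q⁺ (y∈e₁ , x∉p⇒x∈∁p y∉e₂) , y∉
  where
  τ = transpose y x

  y∉ : y ∉ image τ e₁ ∩ ∁ e₂
  y∉ y∈ = x∉e₁ (subst (_∈ e₁) (transpose-matchʳ x y) (∈-image⁻ τ (proj₁ (x∈p∩q⁻ _ _ y∈))))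

  shrink : image τ e₁ ∩ ∁ e₂ ⊆ e₁ ∩ ∁ e₂
  shrink {z} z∈ = x∈p∩q⁺ (subst (_∈ e₁) (transpose-mismatch x y z≢x z≢y) preimage∈e₁ , z∈∁e₂)
    where
    z∈∁e₂ = proj₂ (x∈p∩q⁻ (image τ e₁) (∁ e₂) z∈)
    preimage∈e₁ = ∈-image⁻ τ (proj₁ (x∈p∩q⁻ (image τ e₁) (∁ e₂) z∈))
    z≢x : ¬ z ≡ x
    z≢x refl = x∈∁p⇒x∉p z∈∁e₂ x∈e₂
    z≢y : ¬ z ≡ y
    z≢y refl = x∉e₁ (subst (_∈ e₁) (transpose-matchʳ x y) preimage∈e₁)

SwapClosed : Labeling n p → Subset n → Set
SwapClosed lab C = ∀ {x y} → x ∈ C → y ∈ C → IsAut lab (transpose x y)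

module _ (lab : Labeling n p) where

  FullySymmetric⇒SymLeAut : FullySymmetric lab C → SymLeAut lab C
  FullySymmetric⇒SymLeAut fs π π-fixes e ne =
    fs (image π e) e (image-nonempty π ne) ne (∣image∣ π e) (image-∩∁ π π-fixes e)

  SymLeAut⇒SwapClosed : SymLeAut lab C → SwapClosed lab C
  SymLeAut⇒SwapClosed sym-aut {x} {y} x∈C y∈C = sym-aut (transpose x y) (transpose-InSym x∈C y∈C)

  SwapClosed⇒FullySymmetric : SwapClosed lab C → FullySymmetric lab C
  SwapClosed⇒FullySymmetric {C = C} swap e₁ e₂ ne₁ _ = descend e₁ (<-wellFounded _) ne₁
    where
    descend : ∀ e → Acc _<_ ∣ e ∩ ∁ e₂ ∣ → Nonempty e → ∣ e ∣ ≡ ∣ e₂ ∣ → e ∩ ∁ C ≡ e₂ ∩ ∁ C → lab e ≡ lab e₂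
    descend e (acc smaller) ne ∣e∣≡∣e₂∣ e≈e₂ with ⊆⊎∃∉ e e₂
    ... | inj₁ e⊆e₂ = cong lab (p⊆q∧∣q∣≤∣p∣⇒p≡q e⊆e₂ (≤-reflexive (sym ∣e∣≡∣e₂∣)))
    ... | inj₂ (y , y∈e , y∉e₂) with ∣p∣≤∣q∣∧p⊈q⇒∃q∖p (≤-reflexive ∣e∣≡∣e₂∣) y∈e y∉e₂
    ...   | x , x∈e₂ , x∉e = trans (sym (swap y∈C x∈C e ne))
              (descend (image τ e) (smaller (p⊂q⇒∣p∣<∣q∣ (transpose-shrinks y∈e y∉e₂ x∈e₂ x∉e)))
                (image-nonempty τ ne) (trans (∣image∣ τ e) ∣e∣≡∣e₂∣)
                (trans (image-∩∁ τ (transpose-InSym y∈C x∈C) e) e≈e₂))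
      where
      y∈C = ∩∁-≡⇒∈ e≈e₂ y∈e y∉e₂
      x∈C = ∩∁-≡⇒∈ (sym e≈e₂) x∈e₂ x∉e
      τ = transpose y x

  SymLeAut⇒FullySymmetric : SymLeAut lab C → FullySymmetric lab C
  SymLeAut⇒FullySymmetric = SwapClosed⇒FullySymmetric ∘′ SymLeAut⇒SwapClosed

  IsAut-transpose-trans : IsAut lab (transpose x z) → IsAut lab (transpose z y) → IsAut lab (transpose x y)
  IsAut-transpose-trans {x = x} {z} {y} xz-aut zy-aut with x ≟ z | z ≟ y | x ≟ y
  ... | yes refl | _        | _        = zy-aut
  ... | no _     | yes refl | _        = xz-aut
  ... | no _     | no _     | yes refl = IsAut-cong lab idₚ (transpose x x) (λ w → sym (transpose-same x w)) (IsAut-id lab)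
  ... | no x≢z   | no z≢y   | no x≢y   =
    IsAut-cong lab (transpose x z ∘ₚ transpose z y ∘ₚ transpose x z) (transpose x y)
      (λ w → sym (transpose-conjugate x≢y x≢z (z≢y ∘′ sym) w))
      (IsAut-∘ₚ lab (transpose x z) (transpose z y ∘ₚ transpose x z) xz-aut
        (IsAut-∘ₚ lab (transpose z y) (transpose x z) zy-aut xz-aut))

  SwapClosed-∪ : SwapClosed lab C → SwapClosed lab D → Nonempty (C ∩ D) → SwapClosed lab (C ∪ D)
  SwapClosed-∪ {C = C} {D} swapC swapD (z , z∈C∩D) x∈C∪D y∈C∪D =
    IsAut-transpose-trans (toward x∈C∪D) (away y∈C∪D)
    where
    z∈C = proj₁ (x∈p∩q⁻ C D z∈C∩D)
    z∈D = proj₂ (x∈p∩q⁻ C D z∈C∩D)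

    toward : x ∈ C ∪ D → IsAut lab (transpose x z)
    toward x∈C∪D with x∈p∪q⁻ C D x∈C∪D
    ... | inj₁ x∈C = swapC x∈C z∈C
    ... | inj₂ x∈D = swapD x∈D z∈D

    away : y ∈ C ∪ D → IsAut lab (transpose z y)
    away y∈C∪D with x∈p∪q⁻ C D y∈C∪D
    ... | inj₁ y∈C = swapC z∈C y∈C
    ... | inj₂ y∈D = swapD z∈D y∈D

  FullySymmetric-∪ : FullySymmetric lab C → FullySymmetric lab D → Nonempty (C ∩ D) → FullySymmetric lab (C ∪ D)
  FullySymmetric-∪ fsC fsD C∩D≢∅ = SwapClosed⇒FullySymmetric
    (SwapClosed-∪ (SymLeAut⇒SwapClosed (FullySymmetric⇒SymLeAut fsC))
                  (SymLeAut⇒SwapClosed (FullySymmetric⇒SymLeAut fsD)) C∩D≢∅)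

  SymLeAut-image : SymLeAut lab C → (π : Permutation′ n) → IsAut lab π → SymLeAut lab (image π C)
  SymLeAut-image {C = C} sym-aut π π-aut σ σ-fixes =
    IsAut-cong lab ((flip π ∘ₚ τ) ∘ₚ π) σ conjugate
      (IsAut-∘ₚ lab (flip π ∘ₚ τ) π (IsAut-∘ₚ lab (flip π) τ (IsAut-flip lab π π-aut) τ-aut) π-aut)
    where
    τ = π ∘ₚ σ ∘ₚ flip π

    τ-aut : IsAut lab τ
    τ-aut = sym-aut τ λ x x∉C →
      trans (cong (π ⟨$⟩ˡ_) (σ-fixes (π ⟨$⟩ʳ x) (∉-image-⟨$⟩ʳ π x∉C))) (inverseˡ π)

    conjugate : ((flip π ∘ₚ τ) ∘ₚ π) ≗ₚ σ
    conjugate x = trans (inverseʳ π) (cong (σ ⟨$⟩ʳ_) (inverseʳ π))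

  FullySymmetric-image : FullySymmetric lab C → (π : Permutation′ n) → IsAut lab π → FullySymmetric lab (image π C)
  FullySymmetric-image fs π π-aut = SymLeAut⇒FullySymmetric (SymLeAut-image (FullySymmetric⇒SymLeAut fs) π π-aut)

-- Restriction to an invariant subset

Invariant : Permutation′ n → Subset n → Set
Invariant π C = (∀ {x} → x ∈ C → π ⟨$⟩ʳ x ∈ C) × (∀ {x} → x ∈ C → π ⟨$⟩ˡ x ∈ C)

Invariant-∁ : (π : Permutation′ n) → Invariant π C → Invariant π (∁ C)
Invariant-∁ {C = C} π (πC⊆C , π⁻¹C⊆C) =
    (λ x∈∁C → x∉p⇒x∈∁p λ πx∈C → x∈∁p⇒x∉p x∈∁C (subst (_∈ C) (inverseˡ π) (π⁻¹C⊆C πx∈C)))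
  , (λ x∈∁C → x∉p⇒x∈∁p λ π⁻¹x∈C → x∈∁p⇒x∉p x∈∁C (subst (_∈ C) (inverseʳ π) (πC⊆C π⁻¹x∈C)))

module _ (C : Subset n) where

  onlyOn : (Fin n → Fin n) → Fin n → Fin n
  onlyOn f x = if does (x ∈? C) then f x else x

  onlyOn-∈ : (f : Fin n → Fin n) → x ∈ C → onlyOn f x ≡ f x
  onlyOn-∈ {x} f x∈C with x ∈? C
  ... | yes _   = refl
  ... | no x∉C  = contradiction x∈C x∉C

  onlyOn-∉ : (f : Fin n → Fin n) → x ∉ C → onlyOn f x ≡ x
  onlyOn-∉ {x} f x∉C with x ∈? C
  ... | yes x∈C = contradiction x∈C x∉C
  ... | no _    = refl

  onlyOn-inverse : (f g : Fin n → Fin n) → (∀ {x} → x ∈ C → f x ∈ C) → (∀ x → g (f x) ≡ x) →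
                   ∀ x → onlyOn g (onlyOn f x) ≡ x
  onlyOn-inverse f g f-preserves g∘f≗id x = cases (x ∈? C)
    where
    cases : Dec (x ∈ C) → onlyOn g (onlyOn f x) ≡ x
    cases (yes x∈C) = trans (cong (onlyOn g) (onlyOn-∈ f x∈C)) (trans (onlyOn-∈ g (f-preserves x∈C)) (g∘f≗id x))
    cases (no x∉C)  = trans (cong (onlyOn g) (onlyOn-∉ f x∉C)) (onlyOn-∉ g x∉C)

  restrict : (π : Permutation′ n) → Invariant π C → Permutation′ n
  restrict π (πC⊆C , π⁻¹C⊆C) = permutation (onlyOn (π ⟨$⟩ʳ_)) (onlyOn (π ⟨$⟩ˡ_))
    (onlyOn-inverse (π ⟨$⟩ˡ_) (π ⟨$⟩ʳ_) π⁻¹C⊆C (λ _ → inverseʳ π))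
    (onlyOn-inverse (π ⟨$⟩ʳ_) (π ⟨$⟩ˡ_) πC⊆C (λ _ → inverseˡ π))

  restrict-∈ : (π : Permutation′ n) (inv : Invariant π C) → x ∈ C → restrict π inv ⟨$⟩ʳ x ≡ π ⟨$⟩ʳ x
  restrict-∈ π _ = onlyOn-∈ (π ⟨$⟩ʳ_)

  restrict-InSym : (π : Permutation′ n) (inv : Invariant π C) → InSym C (restrict π inv)
  restrict-InSym π _ x = onlyOn-∉ (π ⟨$⟩ʳ_)

restrict-decomposes : (π : Permutation′ n) (inv : Invariant π C) →
                      π ≗ₚ (restrict (∁ C) π (Invariant-∁ π inv) ∘ₚ restrict C π inv)
restrict-decomposes {C = C} π inv x = cases (x ∈? C)
  where
  open ≡-Reasoning
  inv∁ = Invariant-∁ π inv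
  σ = restrict C π inv
  γ = restrict (∁ C) π inv∁

  cases : Dec (x ∈ C) → π ⟨$⟩ʳ x ≡ σ ⟨$⟩ʳ (γ ⟨$⟩ʳ x)
  cases (yes x∈C) = sym (begin
    σ ⟨$⟩ʳ (γ ⟨$⟩ʳ x)  ≡⟨ cong (σ ⟨$⟩ʳ_) (restrict-InSym (∁ C) π inv∁ x (x∈p⇒x∉∁p x∈C)) ⟩
    σ ⟨$⟩ʳ x           ≡⟨ restrict-∈ C π inv x∈C ⟩
    π ⟨$⟩ʳ x           ∎)
  cases (no x∉C) = sym (begin
    σ ⟨$⟩ʳ (γ ⟨$⟩ʳ x)  ≡⟨ cong (σ ⟨$⟩ʳ_) (restrict-∈ (∁ C) π inv∁ (x∉p⇒x∈∁p x∉C)) ⟩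
    σ ⟨$⟩ʳ (π ⟨$⟩ʳ x)  ≡⟨ restrict-InSym C π inv _ (x∈∁p⇒x∉p (proj₁ inv∁ (x∉p⇒x∈∁p x∉C))) ⟩
    π ⟨$⟩ʳ x           ∎)

-- Maximal fully symmetric sets

module _ (lab : Labeling n p) {C : Subset n} (maximal : MaximalFullySymmetric lab C) (large : n < 2 * ∣ C ∣) where

  image-⊆-maximal : (π : Permutation′ n) → IsAut lab π → image π C ⊆ C
  image-⊆-maximal π π-aut = subst (image π C ⊆_) C∪πC≡C (q⊆p∪q C (image π C))
    where
    fsC = proj₁ maximal

    C∩πC≢∅ : Nonempty (C ∩ image π C)
    C∩πC≢∅ = n<∣p∣+∣q∣⇒p∩q≢∅ C (image π C)
      (subst (λ k → n < ∣ C ∣ + k) (trans (+-identityʳ ∣ C ∣) (sym (∣image∣ π C))) large)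

    C∪πC≡C : C ∪ image π C ≡ C
    C∪πC≡C = proj₂ maximal (C ∪ image π C)
      (FullySymmetric-∪ lab fsC (FullySymmetric-image lab fsC π π-aut) C∩πC≢∅) (p⊆p∪q (image π C))

  Aut-Invariant : (π : Permutation′ n) → IsAut lab π → Invariant π C
  Aut-Invariant π π-aut =
      (λ x∈C → image-⊆-maximal π π-aut (∈-image-⟨$⟩ʳ π x∈C))
    , (λ x∈C → image-⊆-maximal (flip π) (IsAut-flip lab π π-aut) (∈-image-⟨$⟩ʳ (flip π) x∈C))

  Aut≡Sym×Γ : AutIsSymTimes lab C
  Aut≡Sym×Γ = Γ , IsSubgroup-× (IsAut-isSubgroup lab) (InSym-isSubgroup (∁ C)) , (λ _ → proj₂) ,
              λ π → mk⇔ (split π) (join π)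
    where
    Γ : Permutation′ n → Set
    Γ γ = IsAut lab γ × InSym (∁ C) γ

    Sym-aut : ∀ σ → InSym C σ → IsAut lab σ
    Sym-aut = FullySymmetric⇒SymLeAut lab (proj₁ maximal)

    split : ∀ π → IsAut lab π → ∃ λ σ → ∃ λ γ → InSym C σ × Γ γ × (∀ x → π ⟨$⟩ʳ x ≡ σ ⟨$⟩ʳ (γ ⟨$⟩ʳ x))
    split π π-aut = σ , γ , restrict-InSym C π inv , (γ-aut , restrict-InSym (∁ C) π inv∁) , π≗σγ
      where
      inv = Aut-Invariant π π-aut
      inv∁ = Invariant-∁ π inv
      σ = restrict C π inv
      γ = restrict (∁ C) π inv∁
      π≗σγ = restrict-decomposes π inv

      γ-aut : IsAut lab γ
      γ-aut = IsAut-cong lab (π ∘ₚ flip σ) γ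
        (λ x → trans (cong (σ ⟨$⟩ˡ_) (π≗σγ x)) (inverseˡ σ))
        (IsAut-∘ₚ lab π (flip σ) π-aut (Sym-aut (flip σ) (λ x → InSym-⟨$⟩ˡ σ (restrict-InSym C π inv))))

    join : ∀ π → (∃ λ σ → ∃ λ γ → InSym C σ × Γ γ × (∀ x → π ⟨$⟩ʳ x ≡ σ ⟨$⟩ʳ (γ ⟨$⟩ʳ x))) → IsAut lab π
    join π (σ , γ , σ-fixes , (γ-aut , _) , π≗σγ) =
      IsAut-cong lab (γ ∘ₚ σ) π (λ x → sym (π≗σγ x)) (IsAut-∘ₚ lab γ σ γ-aut (Sym-aut σ σ-fixes))

fact16 : (n p : ℕ) → Prime p → (lab : Labeling n p) →
    ((C : Subset n) → FullySymmetric lab C ⇔ SymLeAut lab C) ×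
    ((C D : Subset n) → FullySymmetric lab C → FullySymmetric lab D →
    Nonempty (C ∩ D) → FullySymmetric lab (C ∪ D)) ×
    ((C : Subset n) → MaximalFullySymmetric lab C → n < 2 * ∣ C ∣ →
    AutIsSymTimes lab C)
fact16 n p _ lab =
    (λ C → mk⇔ (FullySymmetric⇒SymLeAut lab) (SymLeAut⇒FullySymmetric lab))
  , (λ C D → FullySymmetric-∪ lab)
  , (λ C maximal large → Aut≡Sym×Γ lab maximal large)
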